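{- The forest polynomials $\mathfrak{P}_F$, as $F$ ranges over all indexed forests, form a basis of the polynomial ring $\mathbb{Z}[x_1,x_2,x_3,\dots]$.
   Context: An indexed tree $(T,I)$ consists of an interval $I=[a,b]\subset\mathbb{Z}_{>0}$ with $a<b$ and a rooted plane (full) binary tree $T$ with $b-a$ internal nodes, completed by $b-a+1$ leaves so that every internal node has exactly a left child and a right child; the leaves are labeled from left to right by $a,a+1,\dots,b$. An indexed forest $F$ is a finite collection of indexed trees whose intervals are pairwise disjoint (the empty forest is allowed). Let $\mathrm{IN}(F)$ be the set of internal nodes of $F$. Labeled flag $\Phi_F$: consider the alphabet of symbols $m_i$ with $m,i\in\mathbb{Z}_{>0}$, ordered lexicographically ($m_i<m'_{i'}$ iff $m<m'$, or $m=m'$ and $i<i'$), with value $\mathrm{val}(m_i)=m$. For each leaf that is a left child, with label $m$, let $v_1,\dots,v_k$ be the internal nodes on the maximal path going up from that leaf through left-child edges only (so $v_1$ is the parent of the leaf, $v_{2}$ is the parent of $v_1$ with $v_1$ its left child, etc.), listed from bottom to top; set $\Phi_F(v_i)=m_i$. This assigns a value to every internal node. The forest polynomial $\mathfrak{P}_F$ is the sum of the monomials $\prod_{v\in\mathrm{IN}(F)}x_{f(v)}$ over all functions $f:\mathrm{IN}(F)\to\mathbb{Z}_{>0}$ such that $f(v)\le\mathrm{val}(\Phi_F(v))$ for all $v$, $f(u)\ge f(v)$ whenever $u$ is the left child of the internal node $v$, and $f(u)>f(v)$ whenever $u$ is the right child of the internal node $v$. (Equivalently, viewing $\mathrm{IN}(F)$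 as a poset in which each internal child is covered by its parent, these are the functions with $f(u)\ge f(v)$ when $u$ is covered by $v$, strictly when $\Phi_F(u)>\Phi_F(v)$, and $f(u)\le \mathrm{val}(\Phi_F(u))$.) The empty forest gives $\mathfrak{P}_F=1$. -}

module Defs where

open import Data.Nat using (ℕ; zero; suc; _+_; _≤_; _<_; _≤ᵇ_; _<ᵇ_; _≡ᵇ_)
open import Data.Integer as ℤ using (ℤ) renaming (_+_ to _+ℤ_; _*_ to _*ℤ_)
open import Data.Bool using (Bool; true; false; _∧_; if_then_else_)
open import Data.List using (List; []; _∷_; _++_; map; concatMap; upTo; filterᵇ; length; foldr)
open import Data.List.Relation.Unary.Linked using (Linked)
open import Data.List.Relation.Unary.Unique.Propositional using (Unique)
open import Data.List.Relation.Unary.All using (All)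
open import Data.Product using (Σ; _×_; _,_; proj₁; proj₂)
open import Relation.Binary.PropositionalEquality using (_≡_)

-- A monomial is a finite list (word) of variable codes, read as a
-- multiset: the code i stands for the variable x_(i+1).  A polynomial is
-- a finite formal sum of terms (coefficient , monomial).

Mono : Set
Mono = List ℕ

Poly : Set
Poly = List (ℤ × Mono)

occ : ℕ → Mono → ℕ
occ i []       = 0
occ i (j ∷ js) = if i ≡ᵇ j then suc (occ i js) else occ i js

allᵇ : (ℕ → Bool) → List ℕ → Bool
allᵇ p []       = true
allᵇ p (x ∷ xs) = p x ∧ allᵇ p xs

sameMono : Mono → Mono → Bool
sameMono u w = allᵇ (λ i → occ i u ≡ᵇ occ i w) (u ++ w)

coeff : Poly → Mono → ℤ
coeff []             m = ℤ.0ℤ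
coeff ((c , u) ∷ ts) m = if sameMono u m then c +ℤ coeff ts m else coeff ts m

infix 4 _≈_
_≈_ : Poly → Poly → Set
p ≈ q = ∀ m → coeff p m ≡ coeff q m

0P : Poly
0P = []

1P : Poly
1P = (ℤ.1ℤ , []) ∷ []

_*P_ : Poly → Poly → Poly
p *P q = concatMap (λ s → map (λ t → (proj₁ s *ℤ proj₁ t , proj₂ s ++ proj₂ t)) q) p

scale : ℤ → Poly → Poly
scale c p = map (λ t → (c *ℤ proj₁ t , proj₂ t)) p

data Tree : Set where
  leaf : Tree
  node : Tree → Tree → Tree

internals : Tree → ℕ
internals leaf       = 0
internals (node l r) = suc (internals l + internals r)

leaves : Tree → ℕ
leaves leaf       = 1
leaves (node l r) = leaves l + leaves r

leftSpine : Tree → ℕ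
leftSpine leaf       = 0
leftSpine (node l r) = suc (leftSpine l)

-- Indexed tree (T, [a, b]) : a ≥ 1, T has at least one internal node
-- (its root is node l r), b = a + #internal nodes, leaves labeled
-- a, a+1, …, b from left to right.
record IndexedTree : Set where
  constructor itree
  field
    start   : ℕ
    start≥1 : 1 ≤ start
    left    : Tree
    right   : Tree

  shape : Tree
  shape = node left right

  end : ℕ
  end = start + internals shape

open IndexedTree public

-- Indexed forest: finite set of indexed trees with pairwise disjoint
-- intervals, represented canonically as the list of its trees sorted by
-- interval (each interval ends strictly before the next starts).
Forest : Set
Forest = Σ (List IndexedTree) (Linked (λ s t → end s < start t))

-- For an internal node v whose subtree is T_v and
-- whose leftmost leaf carries label m, Φ(v) = m_i where i = leftSpine(T_v)
-- (the position of v on the maximal left path above that leaf).  We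
-- represent the symbol m_i by the pair (m , i); val(m_i) = m.

Φ : (m : ℕ) → (T_v : Tree) → ℕ × ℕ
Φ m T_v = m , leftSpine T_v

val : ℕ × ℕ → ℕ
val = proj₁

-- Functions f : IN(T) → ℤ_{>0}, represented as decorations of the
-- internal nodes of T by natural numbers.

data DTree : Set where
  dleaf : DTree
  dnode : ℕ → DTree → DTree → DTree

allDec : ℕ → Tree → List DTree
allDec N leaf       = dleaf ∷ []
allDec N (node l r) =
  concatMap (λ k → concatMap (λ dl → map (λ dr → dnode k dl dr) (allDec N r))
                             (allDec N l))
            (map suc (upTo N))

leftOK : ℕ → DTree → Bool
leftOK k dleaf          = true
leftOK k (dnode k' _ _) = k ≤ᵇ k'

rightOK : ℕ → DTree → Bool
rightOK k dleaf          = true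
rightOK k (dnode k' _ _) = k <ᵇ k'

-- admissibility of a decoration of T, where m is the label of the
-- leftmost leaf of T:  1 ≤ f(v) ≤ val(Φ(v)) and the child conditions.
admissible : ℕ → Tree → DTree → Bool
admissible m leaf       dleaf            = true
admissible m (node l r) (dnode k dl dr)  =
  (1 ≤ᵇ k) ∧ (k ≤ᵇ val (Φ m (node l r))) ∧ leftOK k dl ∧ rightOK k dr
  ∧ admissible m l dl ∧ admissible (m + leaves l) r dr
admissible m _          _                = false

-- the monomial ∏_v x_{f(v)}  (value k ≥ 1 is the variable code k - 1)
monoOf : DTree → Mono
monoOf dleaf           = []
monoOf (dnode k dl dr) = Data.Nat.pred k ∷ (monoOf dl ++ monoOf dr)

-- forest polynomial of an indexed tree: sum over admissible f.
-- All values val(Φ(v)) are ≤ end t, so bounding f by end t loses nothing.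
treePoly : IndexedTree → Poly
treePoly t =
  map (λ d → (ℤ.1ℤ , monoOf d))
      (filterᵇ (admissible (start t) (shape t)) (allDec (end t) (shape t)))

-- forest polynomial: the admissibility conditions do not link different
-- trees, so 𝔓_F is the product of the polynomials of its trees.
forestPoly : Forest → Poly
forestPoly (ts , _) = foldr (λ t p → treePoly t *P p) 1P ts

lincomb : List (ℤ × Forest) → Poly
lincomb cs = concatMap (λ cF → scale (proj₁ cF) (forestPoly (proj₂ cF))) cs

IsBasisOfForestPolys : Set
IsBasisOfForestPolys =
  (∀ (p : Poly) → Σ (List (ℤ × Forest)) (λ cs → p ≈ lincomb cs))
  × (∀ (cs : List (ℤ × Forest)) → Unique (map proj₂ cs) →
       lincomb cs ≈ 0P → All (λ cF → proj₁ cF ≡ ℤ.0ℤ) cs)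

-- Order monomials by weight, the sum of their variable codes.  Among the admissible
-- decorations of an indexed tree, the pointwise largest one, f(v) = val Φ(v), is the unique
-- one of maximal weight, so 𝔓_F is x^c(F) plus terms of smaller weight, where c(F)_m counts
-- the internal nodes whose leftmost leaf is labelled m (for a forest the leading monomials of
-- the trees multiply).  F ↦ c(F) is a bijection onto exponent vectors: writing the forest as a
-- list of trees with bare leaves at the unused labels, c(F) is the concatenation of the
-- left-spine lengths above the leaves, and a stack machine reading these counts from the
-- right rebuilds the trees.  This unitriangularity gives spanning by induction on the weight,
-- and linear independence by reading off, in a vanishing combination, the coefficient of the
-- leading monomial of a heaviest forest.

module Submission where

open import Defs

import Algebra.Properties.CommutativeSemigroup as CommutativeSemigroupProperties
open import Data.Bool using (true; false; T; T?; if_then_else_; _∧_)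
open import Data.Bool.Properties using (T-∧)
open import Data.Empty using (⊥-elim)
open import Data.Integer as ℤ using (ℤ; 0ℤ; 1ℤ; -1ℤ) renaming (_+_ to _+ℤ_; _*_ to _*ℤ_)
import Data.Integer.Properties as ℤₚ
open import Data.Integer.Solver using (module +-*-Solver)
open import Data.List using (List; []; _∷_; _++_; [_]; map; concat; concatMap; filter; foldr; replicate; length; applyUpTo)
open import Data.List.Membership.Propositional using (_∈_; _∉_; lose)
open import Data.List.Membership.Propositional.Properties using (∈-∃++; ∈-concatMap⁺; ∈-concatMap⁻; ∈-map⁺; ∈-upTo⁺)
open import Data.List.Properties using (map-++; concat-++; ++-assoc; ++-identityʳ; foldr-++; length-++; map-replicate)
open import Data.List.Relation.Binary.Permutation.Propositional using (_↭_; ↭-refl; ↭-sym; ↭-trans; prep; swap; ↭⇒↭ₛ)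
import Data.List.Relation.Binary.Permutation.Propositional as ↭
open import Data.List.Relation.Binary.Permutation.Propositional.Properties using (shift; shifts; ++⁺ˡ; ++⁺)
import Data.List.Relation.Binary.Permutation.Propositional.Properties as ↭ₚ
import Data.List.Relation.Binary.Permutation.Setoid.Properties as PermutationSetoidₚ
open import Data.List.Relation.Unary.All as All using (All; []; _∷_)
import Data.List.Relation.Unary.All.Properties as Allₚ
open import Data.List.Relation.Unary.AllPairs using ([]; _∷_)
open import Data.List.Relation.Unary.Any as Any using (here; there)
open import Data.List.Relation.Unary.Linked as Linked using (Linked; []; [-]; _∷_)
open import Data.List.Relation.Unary.Unique.Propositional using (Unique)
import Data.List.Relation.Unary.Unique.Propositional.Properties as Uniqueₚ
open import Data.Nat as ℕ using (ℕ; zero; suc; _+_; _∸_; _≤_; _<_; z≤n; s≤s; z<s; _≡ᵇ_; _≤ᵇ_; pred)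
open import Data.Nat.ListAction using (sum)
open import Data.Nat.ListAction.Properties using (sum-++; sum-↭)
open import Data.Nat.Properties
open import Data.Product using (Σ; _×_; _,_; proj₁; proj₂)
open import Data.Unit using (⊤; tt)
open import Function using (_∘_)
open import Function.Bundles using (Equivalence)
open import Relation.Binary.Bundles using (Setoid)
import Relation.Binary.Reasoning.Setoid as SetoidReasoning
open import Relation.Binary.Structures using (IsEquivalence)
open import Relation.Binary.PropositionalEquality
  using (setoid; _≡_; _≢_; refl; sym; trans; cong; cong₂; subst; subst₂; module ≡-Reasoning)
open import Relation.Nullary using (¬_; yes; no)
open import Relation.Nullary.Reflects using (Reflects; ofʸ; ofⁿ; fromEquivalence)
open import Relation.Unary using (Decidable)

≡ᵇ-reflects-≡ : ∀ m n → Reflects (m ≡ n) (m ≡ᵇ n)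
≡ᵇ-reflects-≡ m n = fromEquivalence (≡ᵇ⇒≡ m n) (≡⇒≡ᵇ m n)

infix 4 _~_
record _~_ (u w : Mono) : Set where
  constructor mk~
  field occ-≡ : ∀ i → occ i u ≡ occ i w
open _~_ public

~-isEquivalence : IsEquivalence _~_
~-isEquivalence = record
  { refl  = mk~ λ i → refl
  ; sym   = λ u~w → mk~ λ i → sym (occ-≡ u~w i)
  ; trans = λ u~v v~w → mk~ λ i → trans (occ-≡ u~v i) (occ-≡ v~w i)
  }

~-setoid : Setoid _ _
~-setoid = record { isEquivalence = ~-isEquivalence }

open IsEquivalence ~-isEquivalence public
  using () renaming (refl to ~-refl; sym to ~-sym; trans to ~-trans)

occ-++ : ∀ i u w → occ i (u ++ w) ≡ occ i u + occ i w
occ-++ i []      w = refl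
occ-++ i (j ∷ u) w with i ≡ᵇ j
... | true  = cong suc (occ-++ i u w)
... | false = occ-++ i u w

~-++ : ∀ {u u′ w w′} → u ~ u′ → w ~ w′ → u ++ w ~ u′ ++ w′
~-++ {u} {u′} {w} {w′} u~u′ w~w′ = mk~ λ i →
  trans (occ-++ i u w) (trans (cong₂ _+_ (occ-≡ u~u′ i) (occ-≡ w~w′ i)) (sym (occ-++ i u′ w′)))

~-∷ : ∀ x {u w} → u ~ w → x ∷ u ~ x ∷ w
~-∷ x = ~-++ ~-refl

occ-self : ∀ i u → occ i (i ∷ u) ≡ suc (occ i u)
occ-self i u with i ≡ᵇ i | ≡ᵇ-reflects-≡ i i
... | true  | _       = refl
... | false | ofⁿ i≢i = ⊥-elim (i≢i refl)

occ≢0⇒∈ : ∀ i u → occ i u ≢ 0 → i ∈ u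
occ≢0⇒∈ i []      occ≢0 = ⊥-elim (occ≢0 refl)
occ≢0⇒∈ i (j ∷ u) occ≢0 with i ≡ᵇ j | ≡ᵇ-reflects-≡ i j
... | true  | ofʸ refl = here refl
... | false | _        = there (occ≢0⇒∈ i u occ≢0)

∉⇒occ≡0 : ∀ i u → i ∉ u → occ i u ≡ 0
∉⇒occ≡0 i []      _   = refl
∉⇒occ≡0 i (j ∷ u) i∉u with i ≡ᵇ j | ≡ᵇ-reflects-≡ i j
... | true  | ofʸ refl = ⊥-elim (i∉u (here refl))
... | false | _        = ∉⇒occ≡0 i u (i∉u ∘ there)

~-drop : ∀ x u ys zs → x ∷ u ~ ys ++ x ∷ zs → u ~ ys ++ zs
~-drop x u ys zs eq = mk~ λ i → +-cancelˡ-≡ (occ i [ x ]) (occ i u) (occ i (ys ++ zs)) (begin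
  occ i [ x ] + occ i u               ≡⟨ occ-++ i [ x ] u ⟨
  occ i (x ∷ u)                       ≡⟨ occ-≡ eq i ⟩
  occ i (ys ++ x ∷ zs)                ≡⟨ occ-++ i ys (x ∷ zs) ⟩
  occ i ys + occ i (x ∷ zs)           ≡⟨ cong (occ i ys +_) (occ-++ i [ x ] zs) ⟩
  occ i ys + (occ i [ x ] + occ i zs)
    ≡⟨ CommutativeSemigroupProperties.x∙yz≈y∙xz +-commutativeSemigroup (occ i ys) (occ i [ x ]) (occ i zs) ⟩
  occ i [ x ] + (occ i ys + occ i zs) ≡⟨ cong (occ i [ x ] +_) (occ-++ i ys zs) ⟨
  occ i [ x ] + occ i (ys ++ zs)      ∎)
  where open ≡-Reasoning

~-∷⇒∈ : ∀ {x u w} → x ∷ u ~ w → x ∈ w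
~-∷⇒∈ {x} {u} {w} x∷u~w = occ≢0⇒∈ x w λ occ≡0 →
  0≢1+n (trans (sym occ≡0) (trans (sym (occ-≡ x∷u~w x)) (occ-self x u)))

~⇒↭ : ∀ u w → u ~ w → u ↭ w
~⇒↭ []      []      _   = ↭-refl
~⇒↭ []      (j ∷ w) u~w = ⊥-elim (0≢1+n (trans (occ-≡ u~w j) (occ-self j w)))
~⇒↭ (x ∷ u) w       u~w with ys , zs , refl ← ∈-∃++ (~-∷⇒∈ u~w) =
  ↭-trans (prep x (~⇒↭ u (ys ++ zs) (~-drop x u ys zs u~w))) (↭-sym (shift x ys zs))

sum-resp-~ : ∀ {u w} → u ~ w → sum u ≡ sum w
sum-resp-~ {u} {w} u~w = sum-↭ (~⇒↭ u w u~w)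

allᵇ-sound : ∀ p xs → T (allᵇ p xs) → ∀ {x} → x ∈ xs → T (p x)
allᵇ-sound p (y ∷ xs) h (here refl) with p y
... | true = tt
allᵇ-sound p (y ∷ xs) h (there x∈xs) with p y
... | true = allᵇ-sound p xs h x∈xs

allᵇ-complete : ∀ p xs → (∀ x → T (p x)) → T (allᵇ p xs)
allᵇ-complete p []       _ = tt
allᵇ-complete p (x ∷ xs) h with p x | h x
... | true | _ = allᵇ-complete p xs h

sameMono⇒~ : ∀ u w → T (sameMono u w) → u ~ w
sameMono⇒~ u w same = mk~ occ-agrees
  where
  occ-agrees : ∀ i → occ i u ≡ occ i w
  occ-agrees i with occ i (u ++ w) ℕ.≟ 0
  ... | yes occ≡0 = trans (m+n≡0⇒m≡0 (occ i u) occ+occ≡0) (sym (m+n≡0⇒n≡0 (occ i u) occ+occ≡0))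
    where occ+occ≡0 = trans (sym (occ-++ i u w)) occ≡0
  ... | no  occ≢0 = ≡ᵇ⇒≡ _ _ (allᵇ-sound _ (u ++ w) same (occ≢0⇒∈ i (u ++ w) occ≢0))

~⇒sameMono : ∀ u w → u ~ w → T (sameMono u w)
~⇒sameMono u w u~w = allᵇ-complete _ (u ++ w) (λ i → ≡⇒≡ᵇ _ _ (occ-≡ u~w i))

sameMono-reflects-~ : ∀ u w → Reflects (u ~ w) (sameMono u w)
sameMono-reflects-~ u w = fromEquivalence (sameMono⇒~ u w) (~⇒sameMono u w)

sameMono-resp-~ˡ : ∀ {u u′} m → u ~ u′ → sameMono u m ≡ sameMono u′ m
sameMono-resp-~ˡ {u} {u′} m u~u′
  with sameMono u m | sameMono-reflects-~ u m | sameMono u′ m | sameMono-reflects-~ u′ m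
... | true  | _       | true  | _        = refl
... | false | _       | false | _        = refl
... | true  | ofʸ u~m | false | ofⁿ u′≁m = ⊥-elim (u′≁m (~-trans (~-sym u~u′) u~m))
... | false | ofⁿ u≁m | true  | ofʸ u′~m = ⊥-elim (u≁m (~-trans u~u′ u′~m))

coeff-++ : ∀ p q m → coeff (p ++ q) m ≡ coeff p m +ℤ coeff q m
coeff-++ []             q m = sym (ℤₚ.+-identityˡ (coeff q m))
coeff-++ ((c , u) ∷ p) q m with sameMono u m
... | true  = trans (cong (c +ℤ_) (coeff-++ p q m)) (sym (ℤₚ.+-assoc c (coeff p m) (coeff q m)))
... | false = coeff-++ p q m

coeff-↭ : ∀ {p q} → p ↭ q → ∀ m → coeff p m ≡ coeff q m
coeff-↭ ↭.refl m = refl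
coeff-↭ (↭.prep (c , u) p↭q) m with sameMono u m
... | true  = cong (c +ℤ_) (coeff-↭ p↭q m)
... | false = coeff-↭ p↭q m
coeff-↭ (↭.swap (a , u) (b , v) p↭q) m with sameMono u m | sameMono v m
... | true  | true  = trans (cong (λ z → a +ℤ (b +ℤ z)) (coeff-↭ p↭q m))
                           (CommutativeSemigroupProperties.x∙yz≈y∙xz ℤₚ.+-commutativeSemigroup a b _)
... | true  | false = cong (a +ℤ_) (coeff-↭ p↭q m)
... | false | true  = cong (b +ℤ_) (coeff-↭ p↭q m)
... | false | false = coeff-↭ p↭q m
coeff-↭ (↭.trans p↭q q↭r) m = trans (coeff-↭ p↭q m) (coeff-↭ q↭r m)

coeff-scale : ∀ c p m → coeff (scale c p) m ≡ c *ℤ coeff p m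
coeff-scale c []             m = sym (ℤₚ.*-zeroʳ c)
coeff-scale c ((d , u) ∷ p) m with sameMono u m
... | true  = trans (cong (c *ℤ d +ℤ_) (coeff-scale c p m)) (sym (ℤₚ.*-distribˡ-+ c d (coeff p m)))
... | false = coeff-scale c p m

concatMap-↭ : ∀ {A B : Set} (f : A → List B) {xs ys} → xs ↭ ys → concatMap f xs ↭ concatMap f ys
concatMap-↭ f ↭.refl               = ↭-refl
concatMap-↭ f (↭.prep x xs↭ys)     = ++⁺ˡ (f x) (concatMap-↭ f xs↭ys)
concatMap-↭ f (↭.swap x y xs↭ys)   = ↭-trans (++⁺ˡ (f x) (++⁺ˡ (f y) (concatMap-↭ f xs↭ys))) (shifts (f x) (f y))
concatMap-↭ f (↭.trans xs↭ys ys↭zs) = ↭-trans (concatMap-↭ f xs↭ys) (concatMap-↭ f ys↭zs)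

concatMap-++ : ∀ {A B : Set} (f : A → List B) xs ys → concatMap f (xs ++ ys) ≡ concatMap f xs ++ concatMap f ys
concatMap-++ f xs ys = trans (cong concat (map-++ f xs ys)) (sym (concat-++ (map f xs) (map f ys)))

coeff-lincomb-∷ : ∀ c F cs m →
  coeff (lincomb ((c , F) ∷ cs)) m ≡ c *ℤ coeff (forestPoly F) m +ℤ coeff (lincomb cs) m
coeff-lincomb-∷ c F cs m =
  trans (coeff-++ (scale c (forestPoly F)) (lincomb cs) m) (cong (_+ℤ coeff (lincomb cs) m) (coeff-scale c (forestPoly F) m))

coeff-lincomb-++ : ∀ cs ds m → coeff (lincomb (cs ++ ds)) m ≡ coeff (lincomb cs) m +ℤ coeff (lincomb ds) m
coeff-lincomb-++ cs ds m = trans (cong (λ p → coeff p m) (concatMap-++ _ cs ds)) (coeff-++ (lincomb cs) (lincomb ds) m)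

coeff-lincomb-↭ : ∀ {cs ds} → cs ↭ ds → ∀ m → coeff (lincomb cs) m ≡ coeff (lincomb ds) m
coeff-lincomb-↭ cs↭ds = coeff-↭ (concatMap-↭ _ cs↭ds)

-- Leading monomials

weight : Mono → ℕ
weight = sum

Below : ℕ → ℤ × Mono → Set
Below w t = weight (proj₂ t) < w

monomial : Mono → Poly
monomial a = (1ℤ , a) ∷ []

HasLeadingMonomial : Poly → Mono → Set
HasLeadingMonomial p a = Σ Poly λ rest → p ↭ (1ℤ , a) ∷ rest × All (Below (weight a)) rest

coeff-below : ∀ {w} p m → All (Below w) p → w ≤ weight m → coeff p m ≡ 0ℤ
coeff-below []             m []            _   = refl
coeff-below ((c , v) ∷ p) m (v<w ∷ p<w) w≤m with sameMono v m | sameMono-reflects-~ v m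
... | true  | ofʸ v~m = ⊥-elim (<⇒≱ v<w (subst (_ ≤_) (sym (sum-resp-~ v~m)) w≤m))
... | false | _       = coeff-below p m p<w w≤m

coeff-∷-congʳ : ∀ t {p q} m → coeff p m ≡ coeff q m → coeff (t ∷ p) m ≡ coeff (t ∷ q) m
coeff-∷-congʳ t {p} {q} m eq =
  trans (coeff-++ [ t ] p m) (trans (cong (coeff [ t ] m +ℤ_) eq) (sym (coeff-++ [ t ] q m)))

coeff-monomial-~ : ∀ {a m} → a ~ m → coeff (monomial a) m ≡ 1ℤ
coeff-monomial-~ {a} {m} a~m with sameMono a m | sameMono-reflects-~ a m
... | true  | _       = refl
... | false | ofⁿ a≁m = ⊥-elim (a≁m a~m)

coeff-monomial-≁ : ∀ {a m} → ¬ a ~ m → coeff (monomial a) m ≡ 0ℤ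
coeff-monomial-≁ {a} {m} a≁m with sameMono a m | sameMono-reflects-~ a m
... | true  | ofʸ a~m = ⊥-elim (a≁m a~m)
... | false | _       = refl

coeff-monomial-resp-~ : ∀ {a b} m → a ~ b → coeff (monomial a) m ≡ coeff (monomial b) m
coeff-monomial-resp-~ m a~b = cong (λ same → if same then 1ℤ +ℤ 0ℤ else 0ℤ) (sameMono-resp-~ˡ m a~b)

coeff-leading : ∀ {p a} → HasLeadingMonomial p a → ∀ m → weight a ≤ weight m → coeff p m ≡ coeff (monomial a) m
coeff-leading {a = a} (rest , p↭ , rest<a) m a≤m =
  trans (coeff-↭ p↭ m) (coeff-∷-congʳ (1ℤ , a) {rest} {[]} m (coeff-below rest m rest<a a≤m))

monomial≈leading-correction : ∀ {p a} ((rest , _) : HasLeadingMonomial p a) → monomial a ≈ p ++ scale -1ℤ rest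
monomial≈leading-correction {p} {a} (rest , p↭ , _) m = sym (begin
  coeff (p ++ scale -1ℤ rest) m                          ≡⟨ coeff-++ p (scale -1ℤ rest) m ⟩
  coeff p m +ℤ coeff (scale -1ℤ rest) m                  ≡⟨ cong₂ _+ℤ_ (coeff-↭ p↭ m) (coeff-scale -1ℤ rest m) ⟩
  coeff ((1ℤ , a) ∷ rest) m +ℤ -1ℤ *ℤ coeff rest m       ≡⟨ cong (_+ℤ -1ℤ *ℤ coeff rest m) (coeff-++ (monomial a) rest m) ⟩
  coeff (monomial a) m +ℤ coeff rest m +ℤ -1ℤ *ℤ coeff rest m
    ≡⟨ solve 2 (λ x y → x :+ y :+ con -1ℤ :* y := x) refl (coeff (monomial a) m) (coeff rest m) ⟩
  coeff (monomial a) m                                   ∎)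
  where
  open ≡-Reasoning
  open +-*-Solver

termProduct : ℤ × Mono → ℤ × Mono → ℤ × Mono
termProduct (c , u) (d , v) = (c *ℤ d , u ++ v)

*P-congʳ : ∀ p {q q′} → q ↭ q′ → p *P q ↭ p *P q′
*P-congʳ []      q↭q′ = ↭-refl
*P-congʳ (s ∷ p) q↭q′ = ++⁺ (↭ₚ.map⁺ (termProduct s) q↭q′) (*P-congʳ p q↭q′)

*P-congˡ : ∀ {p p′} q → p ↭ p′ → p *P q ↭ p′ *P q
*P-congˡ q = concatMap-↭ (λ s → map (termProduct s) q)

Below-termProduct : ∀ u v s t → weight (proj₂ s) + weight (proj₂ t) < weight u + weight v →
                    Below (weight (u ++ v)) (termProduct s t)
Below-termProduct u v (c , x) (d , y) = subst₂ _<_ (sym (sum-++ x y)) (sym (sum-++ u v))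

leading-*P : ∀ {p q a b} → HasLeadingMonomial p a → HasLeadingMonomial q b → HasLeadingMonomial (p *P q) (a ++ b)
leading-*P {p} {q} {a} {b} (p′ , p↭ , p′<a) (q′ , q↭ , q′<b) =
  rest , ↭-trans (*P-congʳ p q↭) (*P-congˡ ((1ℤ , b) ∷ q′) p↭) , rest<ab
  where
  rest = map (termProduct (1ℤ , a)) q′ ++ p′ *P ((1ℤ , b) ∷ q′)
  q≤b : All (λ t → weight (proj₂ t) ≤ weight b) ((1ℤ , b) ∷ q′)
  q≤b = ≤-refl ∷ All.map <⇒≤ q′<b
  rest<ab : All (Below (weight (a ++ b))) rest
  rest<ab = Allₚ.++⁺
    (Allₚ.map⁺ (All.map (λ {t} → Below-termProduct a b (1ℤ , a) t ∘ +-monoʳ-< (weight a)) q′<b))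
    (Allₚ.concat⁺ (Allₚ.map⁺ (All.map (λ {s} s<a →
      Allₚ.map⁺ (All.map (λ {t} → Below-termProduct a b s t ∘ +-mono-<-≤ s<a) q≤b)) p′<a)))

leaves≡1+internals : ∀ T → leaves T ≡ suc (internals T)
leaves≡1+internals leaf       = refl
leaves≡1+internals (node l r) rewrite leaves≡1+internals l | leaves≡1+internals r =
  cong suc (+-suc (internals l) (internals r))

-- Each node gets the label of its leftmost leaf, i.e. the bound val Φ(v): the pointwise largest admissible f.
maxDecoration : ℕ → Tree → DTree
maxDecoration m leaf       = dleaf
maxDecoration m (node l r) = dnode m (maxDecoration m l) (maxDecoration (m + leaves l) r)

data Dominated : DTree → DTree → Set where
  same    : ∀ {d} → Dominated d d
  lighter : ∀ {d D} → weight (monoOf d) < weight (monoOf D) → Dominated d D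

Dominated⇒≤ : ∀ {d D} → Dominated d D → weight (monoOf d) ≤ weight (monoOf D)
Dominated⇒≤ same          = ≤-refl
Dominated⇒≤ (lighter d<D) = <⇒≤ d<D

weight-dnode : ∀ k dl dr → weight (monoOf (dnode k dl dr)) ≡ pred k + (weight (monoOf dl) + weight (monoOf dr))
weight-dnode k dl dr = cong (pred k +_) (sum-++ (monoOf dl) (monoOf dr))

lighter-dnode : ∀ {k m} dl dr Dl Dr →
  pred k + (weight (monoOf dl) + weight (monoOf dr)) < pred m + (weight (monoOf Dl) + weight (monoOf Dr)) →
  Dominated (dnode k dl dr) (dnode m Dl Dr)
lighter-dnode {k} {m} dl dr Dl Dr = lighter ∘ subst₂ _<_ (sym (weight-dnode k dl dr)) (sym (weight-dnode m Dl Dr))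

Dominated-dnode : ∀ {k m dl dr Dl Dr} → 1 ≤ k → k ≤ m → Dominated dl Dl → Dominated dr Dr →
                  Dominated (dnode k dl dr) (dnode m Dl Dr)
Dominated-dnode {k} {m} {dl} {dr} {Dl} {Dr} 1≤k k≤m dl≼Dl dr≼Dr with k ℕ.≟ m | dl≼Dl | dr≼Dr
... | yes refl | same          | same          = same
... | yes refl | _             | lighter dr<Dr =
  lighter-dnode dl dr Dl Dr (+-monoʳ-< (pred k) (+-mono-≤-< (Dominated⇒≤ dl≼Dl) dr<Dr))
... | yes refl | lighter dl<Dl | same          =
  lighter-dnode dl dr Dl Dr (+-monoʳ-< (pred k) (+-monoˡ-< (weight (monoOf dr)) dl<Dl))
... | no k≢m   | _             | _             =
  lighter-dnode dl dr Dl Dr (+-mono-<-≤ (pred-mono-< {{ℕ.>-nonZero 1≤k}} (≤∧≢⇒< k≤m k≢m))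
                                        (+-mono-≤ (Dominated⇒≤ dl≼Dl) (Dominated⇒≤ dr≼Dr)))

T-∧⁻ : ∀ a {b} → T (a ∧ b) → T a × T b
T-∧⁻ a = Equivalence.to (T-∧ {a})

T-∧⁺ : ∀ {a b} → T a → T b → T (a ∧ b)
T-∧⁺ ta tb = Equivalence.from T-∧ (ta , tb)

admissible-dnode⁻ : ∀ {m l r k dl dr} → T (admissible m (node l r) (dnode k dl dr)) →
  1 ≤ k × k ≤ m × T (admissible m l dl) × T (admissible (m + leaves l) r dr)
admissible-dnode⁻ {m} {l} {r} {k} {dl} {dr} adm =
  let (1≤k , adm₁) = T-∧⁻ (1 ≤ᵇ k) adm
      (k≤m , adm₂) = T-∧⁻ (k ≤ᵇ m) adm₁
      (_   , adm₃) = T-∧⁻ (leftOK k dl) adm₂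
      (_   , adm₄) = T-∧⁻ (rightOK k dr) adm₃
  in ≤ᵇ⇒≤ 1 k 1≤k , ≤ᵇ⇒≤ k m k≤m , T-∧⁻ (admissible m l dl) adm₄

admissible⇒Dominated : ∀ m t d → T (admissible m t d) → Dominated d (maxDecoration m t)
admissible⇒Dominated m leaf       dleaf           _   = same
admissible⇒Dominated m (node l r) (dnode k dl dr) adm =
  let (1≤k , k≤m , adml , admr) = admissible-dnode⁻ {m} {l} {r} adm
  in Dominated-dnode 1≤k k≤m (admissible⇒Dominated m l dl adml) (admissible⇒Dominated (m + leaves l) r dr admr)
admissible⇒Dominated m leaf       (dnode _ _ _)   ()
admissible⇒Dominated m (node l r) dleaf           ()

maxDecoration-leftOK : ∀ m t → T (leftOK m (maxDecoration m t))
maxDecoration-leftOK m leaf       = tt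
maxDecoration-leftOK m (node _ _) = ≤⇒≤ᵇ (≤-refl {m})

maxDecoration-rightOK : ∀ {k m} t → k < m → T (rightOK k (maxDecoration m t))
maxDecoration-rightOK leaf       _   = tt
maxDecoration-rightOK (node _ _) k<m = <⇒<ᵇ k<m

maxDecoration-admissible : ∀ m t → 1 ≤ m → T (admissible m t (maxDecoration m t))
maxDecoration-admissible m leaf       _   = tt
maxDecoration-admissible m (node l r) 1≤m =
  T-∧⁺ (≤⇒≤ᵇ 1≤m) (T-∧⁺ (≤⇒≤ᵇ (≤-refl {m})) (T-∧⁺ (maxDecoration-leftOK m l)
    (T-∧⁺ (maxDecoration-rightOK r m<m+leaves) (T-∧⁺ (maxDecoration-admissible m l 1≤m)
      (maxDecoration-admissible (m + leaves l) r (≤-trans 1≤m (m≤m+n m (leaves l))))))))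
  where
  m<m+leaves : m < m + leaves l
  m<m+leaves = m<m+n m (subst (0 <_) (sym (leaves≡1+internals l)) z<s)

All-map⁺ : ∀ {A B : Set} {P : B → Set} (f : A → B) {xs} → (∀ x → P (f x)) → All P (map f xs)
All-map⁺ f Pf = Allₚ.map⁺ (All.universal Pf _)

All-concatMap⁺ : ∀ {A B : Set} {P : B → Set} (f : A → List B) {xs} → (∀ x → All P (f x)) → All P (concatMap f xs)
All-concatMap⁺ f {xs} Pf = Allₚ.concat⁺ (All-map⁺ f {xs} Pf)

∈-concatMap⁺′ : ∀ {A B : Set} (f : A → List B) {x xs y} → x ∈ xs → y ∈ f x → y ∈ concatMap f xs
∈-concatMap⁺′ f x∈xs y∈fx = ∈-concatMap⁺ f (lose x∈xs y∈fx)

Unique-concatMap⁺ : ∀ {A B : Set} (f : A → List B) (tag : B → A) → (∀ x → All (λ y → tag y ≡ x) (f x)) →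
                    (∀ x → Unique (f x)) → ∀ {xs} → Unique xs → Unique (concatMap f xs)
Unique-concatMap⁺ f tag tagged unique {[]}     []          = []
Unique-concatMap⁺ f tag tagged unique {x ∷ xs} (x∉xs ∷ xs!) =
  Uniqueₚ.++⁺ (unique x) (Unique-concatMap⁺ f tag tagged unique xs!) disjoint
  where
  tag-∈ : ∀ {y} → y ∈ concatMap f xs → tag y ∈ xs
  tag-∈ y∈ = Any.map (λ {x′} y∈fx′ → All.lookup (tagged x′) y∈fx′) (∈-concatMap⁻ f y∈)
  disjoint : ∀ {y} → ¬ (y ∈ f x × y ∈ concatMap f xs)
  disjoint (y∈fx , y∈fxs) = All.lookup x∉xs (subst (_∈ xs) (All.lookup (tagged x) y∈fx) (tag-∈ y∈fxs)) refl

rootLabel : DTree → ℕ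
rootLabel dleaf         = 0
rootLabel (dnode k _ _) = k

leftSub : DTree → DTree
leftSub dleaf         = dleaf
leftSub (dnode _ l _) = l

rightSub : DTree → DTree
rightSub dleaf         = dleaf
rightSub (dnode _ _ r) = r

Unique-allDec : ∀ N t → Unique (allDec N t)
Unique-allDec N leaf       = [] ∷ []
Unique-allDec N (node l r) =
  Unique-concatMap⁺ withRoot rootLabel
    (λ k → All-concatMap⁺ (withLeft k) {allDec N l} λ dl → All-map⁺ (dnode k dl) λ dr → refl)
    (λ k → Unique-concatMap⁺ (withLeft k) leftSub (λ dl → All-map⁺ (dnode k dl) λ dr → refl)
             (λ dl → Uniqueₚ.map⁺ (cong rightSub) (Unique-allDec N r)) (Unique-allDec N l))
    (Uniqueₚ.map⁺ suc-injective (Uniqueₚ.upTo⁺ N))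
  where
  withLeft : ℕ → DTree → List DTree
  withLeft k dl = map (dnode k dl) (allDec N r)
  withRoot : ℕ → List DTree
  withRoot k = concatMap (withLeft k) (allDec N l)

maxDecoration-∈-allDec : ∀ N m t → 1 ≤ m → m + internals t ≤ N → maxDecoration m t ∈ allDec N t
maxDecoration-∈-allDec N m       leaf       _   _ = here refl
maxDecoration-∈-allDec N (suc k) (node l r) 1≤m bound =
  ∈-concatMap⁺′ _ (∈-map⁺ suc (∈-upTo⁺ (≤-trans (m≤m+n (suc k) (internals (node l r))) bound)))
    (∈-concatMap⁺′ _ (maxDecoration-∈-allDec N (suc k) l 1≤m boundˡ)
      (∈-map⁺ _ (maxDecoration-∈-allDec N (suc k + leaves l) r (s≤s z≤n) boundʳ)))
  where
  boundˡ : suc k + internals l ≤ N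
  boundˡ = ≤-trans (+-monoʳ-≤ (suc k) (≤-trans (m≤m+n (internals l) (internals r)) (n≤1+n _))) bound
  boundʳ : suc k + leaves l + internals r ≤ N
  boundʳ = subst (_≤ N) (sym (trans (+-assoc (suc k) (leaves l) (internals r))
                                   (cong (λ n → suc k + (n + internals r)) (leaves≡1+internals l)))) bound

term : DTree → ℤ × Mono
term d = (1ℤ , monoOf d)

module _ {P : DTree → Set} (P? : Decidable P) {D : DTree} (dominated : ∀ {d} → P d → Dominated d D) where

  filter-below : ∀ {L} → All (_≢ D) L → All (Below (weight (monoOf D))) (map term (filter P? L))
  filter-below {[]}    []           = []
  filter-below {d ∷ L} (d≢D ∷ L≢D) with P? d
  ... | no _   = filter-below L≢D
  ... | yes Pd with dominated Pd
  ...   | same        = ⊥-elim (d≢D refl)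
  ...   | lighter d<D = d<D ∷ filter-below L≢D

  filter-leading : P D → ∀ {L} → Unique L → D ∈ L → HasLeadingMonomial (map term (filter P? L)) (monoOf D)
  filter-leading PD {D ∷ L} (D∉L ∷ _) (here refl) with P? D
  ... | yes _   = map term (filter P? L) , ↭-refl , filter-below (All.map (λ D≢d → D≢d ∘ sym) D∉L)
  ... | no ¬PD = ⊥-elim (¬PD PD)
  filter-leading PD {d ∷ L} (d∉L ∷ L!) (there D∈L) with filter-leading PD L! D∈L | P? d
  ... | lead | no _ = lead
  ... | rest , filtered↭ , rest<D | yes Pd with dominated Pd
  ...   | same        = ⊥-elim (All.lookup d∉L D∈L refl)
  ...   | lighter d<D = term d ∷ rest , ↭-trans (prep (term d) filtered↭) (swap (term d) (term D) ↭-refl) , d<D ∷ rest<D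

treeLeadingMonomial : IndexedTree → Mono
treeLeadingMonomial t = monoOf (maxDecoration (start t) (shape t))

treePoly-leading : ∀ t → HasLeadingMonomial (treePoly t) (treeLeadingMonomial t)
treePoly-leading t =
  filter-leading (T? ∘ admissible (start t) (shape t)) (admissible⇒Dominated (start t) (shape t) _)
    (maxDecoration-admissible (start t) (shape t) (start≥1 t))
    (Unique-allDec (end t) (shape t)) (maxDecoration-∈-allDec (end t) (start t) (shape t) (start≥1 t) ≤-refl)

leadingMonomial : List IndexedTree → Mono
leadingMonomial = concatMap treeLeadingMonomial

forestPoly-leading : ∀ F → HasLeadingMonomial (forestPoly F) (leadingMonomial (proj₁ F))
forestPoly-leading (ts , _) = product-leading ts
  where
  product-leading : ∀ ts → HasLeadingMonomial (foldr (λ t p → treePoly t *P p) 1P ts) (leadingMonomial ts)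
  product-leading []       = [] , ↭-refl , []
  product-leading (t ∷ ts) = leading-*P (treePoly-leading t) (product-leading ts)

-- Left-spine counts and their decoding

incHead : List ℕ → List ℕ
incHead []       = []
incHead (x ∷ xs) = suc x ∷ xs

-- Per leaf, left to right: the length of the maximal left-edge path above it.  With the leaves
-- labelled from q+1 on, this is the exponent of the corresponding variable in the leading monomial.
spineCounts : Tree → List ℕ
spineCounts leaf       = 0 ∷ []
spineCounts (node l r) = incHead (spineCounts l) ++ spineCounts r

spineCountsTail : Tree → List ℕ
spineCountsTail leaf       = []
spineCountsTail (node l r) = spineCountsTail l ++ spineCounts r

spineCounts≡ : ∀ t → spineCounts t ≡ leftSpine t ∷ spineCountsTail t
spineCounts≡ leaf       = refl
spineCounts≡ (node l r) rewrite spineCounts≡ l = refl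

spineSubtrees : Tree → List Tree
spineSubtrees leaf       = []
spineSubtrees (node l r) = spineSubtrees l ++ [ r ]

allSpineCounts : List Tree → List ℕ
allSpineCounts = concatMap spineCounts

-- Decoding reads the counts from the right with a stack of trees: a count k pops k trees
-- (leaves once the stack is empty) as the right children of a new left spine of length k.
growSpine : Tree → ℕ → List Tree → Tree × List Tree
growSpine t zero    s       = t , s
growSpine t (suc k) []      = growSpine (node t leaf) k []
growSpine t (suc k) (r ∷ s) = growSpine (node t r) k s

pushTreeFrom : Tree → ℕ → List Tree → List Tree
pushTreeFrom t k s = proj₁ (growSpine t k s) ∷ proj₂ (growSpine t k s)

pushTree : ℕ → List Tree → List Tree
pushTree = pushTreeFrom leaf

decodeTrees : List ℕ → List Tree → List Tree
decodeTrees cs s = foldr pushTree s cs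

graftLeftmost : Tree → Tree → Tree
graftLeftmost t leaf       = t
graftLeftmost t (node l r) = node (graftLeftmost t l) r

graftLeftmost-leaf : ∀ t → graftLeftmost leaf t ≡ t
graftLeftmost-leaf leaf       = refl
graftLeftmost-leaf (node l r) = cong (λ l′ → node l′ r) (graftLeftmost-leaf l)

growSpine-spineSubtrees : ∀ t u j s →
  growSpine u (leftSpine t + j) (spineSubtrees t ++ s) ≡ growSpine (graftLeftmost u t) j s
growSpine-spineSubtrees leaf       u j s = refl
growSpine-spineSubtrees (node l r) u j s
  rewrite ++-assoc (spineSubtrees l) [ r ] s | sym (+-suc (leftSpine l) j) = growSpine-spineSubtrees l u (suc j) (r ∷ s)

mutual
  decodeTrees-spineCounts : ∀ t s → decodeTrees (spineCounts t) s ≡ t ∷ s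
  decodeTrees-spineCounts t s rewrite spineCounts≡ t | decodeTrees-spineCountsTail t s
    | sym (+-identityʳ (leftSpine t)) | growSpine-spineSubtrees t leaf 0 s | graftLeftmost-leaf t = refl

  decodeTrees-spineCountsTail : ∀ t s → decodeTrees (spineCountsTail t) s ≡ spineSubtrees t ++ s
  decodeTrees-spineCountsTail leaf       s = refl
  decodeTrees-spineCountsTail (node l r) s
    rewrite foldr-++ pushTree s (spineCountsTail l) (spineCounts r)
          | decodeTrees-spineCounts r s | decodeTrees-spineCountsTail l (r ∷ s) =
    sym (++-assoc (spineSubtrees l) [ r ] s)

decodeTrees-allSpineCounts : ∀ ts s → decodeTrees (allSpineCounts ts) s ≡ ts ++ s
decodeTrees-allSpineCounts []       s = refl
decodeTrees-allSpineCounts (t ∷ ts) s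
  rewrite foldr-++ pushTree s (spineCounts t) (allSpineCounts ts) | decodeTrees-allSpineCounts ts s =
  decodeTrees-spineCounts t (ts ++ s)

AllZero : List ℕ → Set
AllZero = All (_≡ 0)

allSpineCounts-pushTreeFrom : ∀ t k s → Σ (List ℕ) λ zs → AllZero zs ×
  allSpineCounts (pushTreeFrom t k s) ≡ (k + leftSpine t) ∷ spineCountsTail t ++ allSpineCounts s ++ zs
allSpineCounts-pushTreeFrom t zero s rewrite spineCounts≡ t =
  [] , [] , cong (λ cs → leftSpine t ∷ spineCountsTail t ++ cs) (sym (++-identityʳ (allSpineCounts s)))
allSpineCounts-pushTreeFrom t (suc k) [] with zs , zs≡0 , eq ← allSpineCounts-pushTreeFrom (node t leaf) k [] =
  0 ∷ zs , refl ∷ zs≡0 ,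
  trans eq (cong₂ _∷_ (+-suc k (leftSpine t)) (++-assoc (spineCountsTail t) [ 0 ] zs))
allSpineCounts-pushTreeFrom t (suc k) (r ∷ s) with zs , zs≡0 , eq ← allSpineCounts-pushTreeFrom (node t r) k s =
  zs , zs≡0 ,
  trans eq (cong₂ _∷_ (+-suc k (leftSpine t))
    (trans (++-assoc (spineCountsTail t) (spineCounts r) (allSpineCounts s ++ zs))
           (cong (spineCountsTail t ++_) (sym (++-assoc (spineCounts r) (allSpineCounts s) zs)))))

allSpineCounts-decodeTrees : ∀ cs → Σ (List ℕ) λ zs → AllZero zs × allSpineCounts (decodeTrees cs []) ≡ cs ++ zs
allSpineCounts-decodeTrees []       = [] , [] , refl
allSpineCounts-decodeTrees (k ∷ cs)
  with zs , zs≡0 , eq ← allSpineCounts-decodeTrees cs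
     | zs′ , zs′≡0 , eq′ ← allSpineCounts-pushTreeFrom leaf k (decodeTrees cs []) =
  zs ++ zs′ , Allₚ.++⁺ zs≡0 zs′≡0 ,
  trans eq′ (cong₂ _∷_ (+-identityʳ k) (trans (cong (_++ zs′) eq) (++-assoc cs zs zs′)))

-- The leading monomial determines the forest

-- The trees are labelled consecutively from q + 1; a bare leaf is a label not covered by the forest.
indexTrees : ℕ → List Tree → List IndexedTree
indexTrees q []              = []
indexTrees q (leaf ∷ ts)     = indexTrees (suc q) ts
indexTrees q (node l r ∷ ts) = itree (suc q) (s≤s z≤n) l r ∷ indexTrees (q + leaves (node l r)) ts

Disjoint : IndexedTree → IndexedTree → Set
Disjoint s t = end s < start t

indexTrees-starts : ∀ q ts → All (λ t → q < start t) (indexTrees q ts)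
indexTrees-starts q []              = []
indexTrees-starts q (leaf ∷ ts)     = All.map (<-trans (n<1+n q)) (indexTrees-starts (suc q) ts)
indexTrees-starts q (node l r ∷ ts) =
  s≤s ≤-refl ∷ All.map (≤-trans (s≤s (m≤m+n q (leaves (node l r))))) (indexTrees-starts (q + leaves (node l r)) ts)

Linked-∷ : ∀ {t ts} → All (Disjoint t) ts → Linked Disjoint ts → Linked Disjoint (t ∷ ts)
Linked-∷ {ts = []}    _       _  = [-]
Linked-∷ {ts = _ ∷ _} (d ∷ _) ln = d ∷ ln

indexTrees-linked : ∀ q ts → Linked Disjoint (indexTrees q ts)
indexTrees-linked q []              = []
indexTrees-linked q (leaf ∷ ts)     = indexTrees-linked (suc q) ts
indexTrees-linked q (node l r ∷ ts) =
  Linked-∷ (All.map (≤-trans (s≤s (≤-reflexive end≡))) (indexTrees-starts (q + leaves (node l r)) ts))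
           (indexTrees-linked (q + leaves (node l r)) ts)
  where
  end≡ : suc q + internals (node l r) ≡ q + leaves (node l r)
  end≡ = trans (sym (+-suc q _)) (cong (q +_) (sym (leaves≡1+internals (node l r))))

forestOf : List Tree → Forest
forestOf ts = indexTrees 0 ts , indexTrees-linked 0 ts

monomialFrom : ℕ → List ℕ → Mono
monomialFrom o []       = []
monomialFrom o (c ∷ cs) = replicate c o ++ monomialFrom (suc o) cs

monomialFrom-++ : ∀ o xs ys → monomialFrom o (xs ++ ys) ≡ monomialFrom o xs ++ monomialFrom (length xs + o) ys
monomialFrom-++ o []       ys = refl
monomialFrom-++ o (x ∷ xs) ys rewrite monomialFrom-++ (suc o) xs ys | +-suc (length xs) o =
  sym (++-assoc (replicate x o) (monomialFrom (suc o) xs) _)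

length-incHead : ∀ xs → length (incHead xs) ≡ length xs
length-incHead []       = refl
length-incHead (x ∷ xs) = refl

length-spineCounts : ∀ t → length (spineCounts t) ≡ leaves t
length-spineCounts leaf       = refl
length-spineCounts (node l r) = trans (length-++ (incHead (spineCounts l)))
  (cong₂ _+_ (trans (length-incHead (spineCounts l)) (length-spineCounts l)) (length-spineCounts r))

monomialFrom-incHead : ∀ o t → monomialFrom o (incHead (spineCounts t)) ≡ o ∷ monomialFrom o (spineCounts t)
monomialFrom-incHead o t rewrite spineCounts≡ t = refl

maxDecoration~monomialFrom : ∀ q t → monoOf (maxDecoration (suc q) t) ~ monomialFrom q (spineCounts t)
maxDecoration~monomialFrom q leaf       = ~-refl
maxDecoration~monomialFrom q (node l r) = begin
  q ∷ monoOf (maxDecoration (suc q) l) ++ monoOf (maxDecoration (suc q + leaves l) r)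
    ≈⟨ ~-∷ q (~-++ (maxDecoration~monomialFrom q l) (maxDecoration~monomialFrom (q + leaves l) r)) ⟩
  q ∷ monomialFrom q (spineCounts l) ++ monomialFrom (q + leaves l) (spineCounts r)
    ≡⟨ cong₂ (λ o cs → o ++ monomialFrom cs (spineCounts r)) (sym (monomialFrom-incHead q l)) offset ⟩
  monomialFrom q (incHead (spineCounts l)) ++ monomialFrom (length (incHead (spineCounts l)) + q) (spineCounts r)
    ≡⟨ monomialFrom-++ q (incHead (spineCounts l)) (spineCounts r) ⟨
  monomialFrom q (spineCounts (node l r)) ∎
  where
  open SetoidReasoning ~-setoid
  offset : q + leaves l ≡ length (incHead (spineCounts l)) + q
  offset = trans (+-comm q (leaves l)) (cong (_+ q) (sym (trans (length-incHead (spineCounts l)) (length-spineCounts l))))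

leadingMonomial-indexTrees : ∀ q ts → leadingMonomial (indexTrees q ts) ~ monomialFrom q (allSpineCounts ts)
leadingMonomial-indexTrees q []              = ~-refl
leadingMonomial-indexTrees q (leaf ∷ ts)     = leadingMonomial-indexTrees (suc q) ts
leadingMonomial-indexTrees q (node l r ∷ ts) = begin
  treeLeadingMonomial (itree (suc q) (s≤s z≤n) l r) ++ leadingMonomial (indexTrees (q + leaves t) ts)
    ≈⟨ ~-++ (maxDecoration~monomialFrom q t) (leadingMonomial-indexTrees (q + leaves t) ts) ⟩
  monomialFrom q (spineCounts t) ++ monomialFrom (q + leaves t) (allSpineCounts ts)
    ≡⟨ cong (λ o → monomialFrom q (spineCounts t) ++ monomialFrom o (allSpineCounts ts))
            (trans (+-comm q (leaves t)) (cong (_+ q) (sym (length-spineCounts t)))) ⟩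
  monomialFrom q (spineCounts t) ++ monomialFrom (length (spineCounts t) + q) (allSpineCounts ts)
    ≡⟨ monomialFrom-++ q (spineCounts t) (allSpineCounts ts) ⟨
  monomialFrom q (allSpineCounts (t ∷ ts)) ∎
  where
  t = node l r
  open SetoidReasoning ~-setoid

entry : ℕ → List ℕ → ℕ
entry i       []       = 0
entry zero    (x ∷ xs) = x
entry (suc i) (x ∷ xs) = entry i xs

monomialFrom-suc : ∀ o cs → monomialFrom (suc o) cs ≡ map suc (monomialFrom o cs)
monomialFrom-suc o []       = refl
monomialFrom-suc o (c ∷ cs) rewrite map-++ suc (replicate c o) (monomialFrom (suc o) cs)
  | map-replicate suc c o | monomialFrom-suc (suc o) cs = refl

occ-suc-map-suc : ∀ i u → occ (suc i) (map suc u) ≡ occ i u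
occ-suc-map-suc i []      = refl
occ-suc-map-suc i (j ∷ u) with i ≡ᵇ j
... | true  = cong suc (occ-suc-map-suc i u)
... | false = occ-suc-map-suc i u

occ-0-map-suc : ∀ u → occ 0 (map suc u) ≡ 0
occ-0-map-suc []      = refl
occ-0-map-suc (j ∷ u) = occ-0-map-suc u

occ-0-replicate : ∀ c → occ 0 (replicate c 0) ≡ c
occ-0-replicate zero    = refl
occ-0-replicate (suc c) = cong suc (occ-0-replicate c)

occ-suc-replicate : ∀ i c → occ (suc i) (replicate c 0) ≡ 0
occ-suc-replicate i zero    = refl
occ-suc-replicate i (suc c) = occ-suc-replicate i c

occ-monomialFrom : ∀ i cs → occ i (monomialFrom 0 cs) ≡ entry i cs
occ-monomialFrom i [] = refl
occ-monomialFrom zero (c ∷ cs) rewrite occ-++ 0 (replicate c 0) (monomialFrom 1 cs) | monomialFrom-suc 0 cs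
  | occ-0-map-suc (monomialFrom 0 cs) | occ-0-replicate c = +-identityʳ c
occ-monomialFrom (suc i) (c ∷ cs) rewrite occ-++ (suc i) (replicate c 0) (monomialFrom 1 cs) | monomialFrom-suc 0 cs
  | occ-suc-map-suc i (monomialFrom 0 cs) | occ-suc-replicate i c = occ-monomialFrom i cs

occ-leadingMonomial-indexTrees : ∀ ts i → occ i (leadingMonomial (indexTrees 0 ts)) ≡ entry i (allSpineCounts ts)
occ-leadingMonomial-indexTrees ts i =
  trans (occ-≡ (leadingMonomial-indexTrees 0 ts) i) (occ-monomialFrom i (allSpineCounts ts))

∈⇒≤sum : ∀ {x} u → x ∈ u → x ≤ sum u
∈⇒≤sum (y ∷ u) (here refl)  = m≤m+n y (sum u)
∈⇒≤sum (y ∷ u) (there x∈u) = ≤-trans (∈⇒≤sum u x∈u) (m≤n+m (sum u) y)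

occ-beyond-weight : ∀ u i → weight u < i → occ i u ≡ 0
occ-beyond-weight u i u<i = ∉⇒occ≡0 i u (λ i∈u → <⇒≱ u<i (∈⇒≤sum u i∈u))

entry-AllZero : ∀ i zs → AllZero zs → entry i zs ≡ 0
entry-AllZero i       []       _             = refl
entry-AllZero zero    (z ∷ zs) (z≡0 ∷ _)     = z≡0
entry-AllZero (suc i) (z ∷ zs) (_ ∷ zs≡0)    = entry-AllZero i zs zs≡0

entry-applyUpTo-++ : ∀ N f zs → (∀ i → N ≤ i → f i ≡ 0) → AllZero zs → ∀ i → entry i (applyUpTo f N ++ zs) ≡ f i
entry-applyUpTo-++ zero    f zs f≡0 zs≡0 i       = trans (entry-AllZero i zs zs≡0) (sym (f≡0 i z≤n))
entry-applyUpTo-++ (suc N) f zs f≡0 zs≡0 zero    = refl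
entry-applyUpTo-++ (suc N) f zs f≡0 zs≡0 (suc i) =
  entry-applyUpTo-++ N (f ∘ suc) zs (λ j N≤j → f≡0 (suc j) (s≤s N≤j)) zs≡0 i

exponents : Mono → List ℕ
exponents u = applyUpTo (λ i → occ i u) (suc (weight u))

decode : Mono → Forest
decode u = forestOf (decodeTrees (exponents u) [])

leadingMonomial-decode : ∀ u → leadingMonomial (proj₁ (decode u)) ~ u
leadingMonomial-decode u with zs , zs≡0 , eq ← allSpineCounts-decodeTrees (exponents u) = mk~ λ i → begin
  occ i (leadingMonomial (indexTrees 0 (decodeTrees (exponents u) [])))
    ≡⟨ occ-leadingMonomial-indexTrees (decodeTrees (exponents u) []) i ⟩
  entry i (allSpineCounts (decodeTrees (exponents u) []))              ≡⟨ cong (entry i) eq ⟩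
  entry i (exponents u ++ zs)                                            ≡⟨ entry-applyUpTo-++ _ _ zs (occ-beyond-weight u) zs≡0 i ⟩
  occ i u                                                                ∎
  where open ≡-Reasoning

data TrailingEq {A : Set} (z : A) : List A → List A → Set where
  []   : TrailingEq z [] []
  _∷_  : ∀ x {xs ys} → TrailingEq z xs ys → TrailingEq z (x ∷ xs) (x ∷ ys)
  padˡ : ∀ {xs} → TrailingEq z xs [] → TrailingEq z (z ∷ xs) []
  padʳ : ∀ {ys} → TrailingEq z [] ys → TrailingEq z [] (z ∷ ys)

TrailingEq-refl : ∀ {A : Set} {z : A} xs → TrailingEq z xs xs
TrailingEq-refl []       = []
TrailingEq-refl (x ∷ xs) = x ∷ TrailingEq-refl xs

TrailingEq-sym : ∀ {A : Set} {z : A} {xs ys} → TrailingEq z xs ys → TrailingEq z ys xs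
TrailingEq-sym []            = []
TrailingEq-sym (x ∷ xs≈ys)   = x ∷ TrailingEq-sym xs≈ys
TrailingEq-sym (padˡ xs≈[])  = padʳ (TrailingEq-sym xs≈[])
TrailingEq-sym (padʳ []≈ys)  = padˡ (TrailingEq-sym []≈ys)

growSpine-TrailingEq : ∀ t k {s s′} → TrailingEq leaf s s′ →
  proj₁ (growSpine t k s) ≡ proj₁ (growSpine t k s′) × TrailingEq leaf (proj₂ (growSpine t k s)) (proj₂ (growSpine t k s′))
growSpine-TrailingEq t zero    s≈s′       = refl , s≈s′
growSpine-TrailingEq t (suc k) []         = refl , TrailingEq-refl _
growSpine-TrailingEq t (suc k) (r ∷ s≈s′) = growSpine-TrailingEq (node t r) k s≈s′
growSpine-TrailingEq t (suc k) (padˡ s≈s′) = growSpine-TrailingEq (node t leaf) k s≈s′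
growSpine-TrailingEq t (suc k) (padʳ s≈s′) = growSpine-TrailingEq (node t leaf) k s≈s′

pushTree-TrailingEq : ∀ k {s s′} → TrailingEq leaf s s′ → TrailingEq leaf (pushTree k s) (pushTree k s′)
pushTree-TrailingEq k s≈s′ with tree≡ , rest≈ ← growSpine-TrailingEq leaf k s≈s′ rewrite tree≡ = _ ∷ rest≈

decodeTrees-TrailingEq : ∀ {cs ds} → TrailingEq 0 cs ds → TrailingEq leaf (decodeTrees cs []) (decodeTrees ds [])
decodeTrees-TrailingEq []             = []
decodeTrees-TrailingEq (c ∷ cs≈ds)    = pushTree-TrailingEq c (decodeTrees-TrailingEq cs≈ds)
decodeTrees-TrailingEq (padˡ cs≈[])   = padˡ (decodeTrees-TrailingEq cs≈[])
decodeTrees-TrailingEq (padʳ []≈ds)   = padʳ (decodeTrees-TrailingEq []≈ds)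

indexTrees-TrailingEq : ∀ q {ts ts′} → TrailingEq leaf ts ts′ → indexTrees q ts ≡ indexTrees q ts′
indexTrees-TrailingEq q []                      = refl
indexTrees-TrailingEq q (leaf ∷ ts≈ts′)         = indexTrees-TrailingEq (suc q) ts≈ts′
indexTrees-TrailingEq q (node l r ∷ ts≈ts′)     = cong (_ ∷_) (indexTrees-TrailingEq _ ts≈ts′)
indexTrees-TrailingEq q (padˡ ts≈[])            = indexTrees-TrailingEq (suc q) ts≈[]
indexTrees-TrailingEq q (padʳ []≈ts)            = indexTrees-TrailingEq (suc q) []≈ts

applyUpTo-TrailingEq : ∀ N f cs → (∀ i → f i ≡ entry i cs) → (∀ i → N ≤ i → f i ≡ 0) → TrailingEq 0 (applyUpTo f N) cs
applyUpTo-TrailingEq zero f [] f≡cs f≡0 = []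
applyUpTo-TrailingEq zero f (c ∷ cs) f≡cs f≡0 rewrite sym (f≡cs 0) | f≡0 0 z≤n =
  padʳ (applyUpTo-TrailingEq zero (f ∘ suc) cs (f≡cs ∘ suc) (λ i _ → f≡0 (suc i) z≤n))
applyUpTo-TrailingEq (suc N) f [] f≡cs f≡0 rewrite f≡cs 0 =
  padˡ (applyUpTo-TrailingEq N (f ∘ suc) [] (f≡cs ∘ suc) (λ i N≤i → f≡0 (suc i) (s≤s N≤i)))
applyUpTo-TrailingEq (suc N) f (c ∷ cs) f≡cs f≡0 rewrite f≡cs 0 =
  c ∷ applyUpTo-TrailingEq N (f ∘ suc) cs (f≡cs ∘ suc) (λ i N≤i → f≡0 (suc i) (s≤s N≤i))

components : ℕ → List IndexedTree → List Tree
components q []       = []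
components q (t ∷ ts) = replicate (pred (start t) ∸ q) leaf ++ shape t ∷ components (pred (start t) + leaves (shape t)) ts

indexTrees-replicate-leaf : ∀ q j ts → indexTrees q (replicate j leaf ++ ts) ≡ indexTrees (j + q) ts
indexTrees-replicate-leaf q zero    ts = refl
indexTrees-replicate-leaf q (suc j) ts rewrite indexTrees-replicate-leaf (suc q) j ts | +-suc j q = refl

StartsAfter : ℕ → List IndexedTree → Set
StartsAfter q []      = ⊤
StartsAfter q (t ∷ _) = q < start t

Linked-StartsAfter : ∀ {t ts} → Linked Disjoint (t ∷ ts) → StartsAfter (end t) ts
Linked-StartsAfter [-]          = tt
Linked-StartsAfter (t<t′ ∷ _)   = t<t′

indexTrees-components : ∀ q ts → Linked Disjoint ts → StartsAfter q ts → indexTrees q (components q ts) ≡ ts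
indexTrees-components q []                           _  _ = refl
indexTrees-components q (t@(itree (suc s) 1≤s l r) ∷ ts) ln (s≤s q≤s)
  rewrite indexTrees-replicate-leaf q (s ∸ q) (node l r ∷ components (s + leaves (node l r)) ts) | m∸n+n≡m q≤s =
  cong₂ _∷_ (cong (λ 1≤s′ → itree (suc s) 1≤s′ l r) (≤-irrelevant _ 1≤s))
            (indexTrees-components (s + leaves (node l r)) ts (Linked.tail ln)
                                   (subst (λ e → StartsAfter e ts) end≡ (Linked-StartsAfter ln)))
  where
  end≡ : end t ≡ s + leaves (node l r)
  end≡ = trans (sym (+-suc s _)) (cong (s +_) (sym (leaves≡1+internals (node l r))))

Forest-≡ : ∀ (F G : Forest) → proj₁ F ≡ proj₁ G → F ≡ G
Forest-≡ (ts , ln) (.ts , ln′) refl = cong (ts ,_) (Linked.irrelevant <-irrelevant ln ln′)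

decode-leadingMonomial : ∀ F u → leadingMonomial (proj₁ F) ~ u → proj₁ F ≡ proj₁ (decode u)
decode-leadingMonomial (ts , ln) u lead~u = begin
  ts                                                  ≡⟨ indexTrees-components 0 ts ln (starts-positive ts) ⟨
  indexTrees 0 S                                      ≡⟨ cong (indexTrees 0) (trans (decodeTrees-allSpineCounts S []) (++-identityʳ S)) ⟨
  indexTrees 0 (decodeTrees (allSpineCounts S) [])    ≡⟨ indexTrees-TrailingEq 0 (decodeTrees-TrailingEq counts≈exponents) ⟩
  indexTrees 0 (decodeTrees (exponents u) [])         ∎
  where
  open ≡-Reasoning
  S = components 0 ts
  starts-positive : ∀ ts → StartsAfter 0 ts
  starts-positive []      = tt
  starts-positive (t ∷ _) = start≥1 t
  occ≡entry : ∀ i → occ i u ≡ entry i (allSpineCounts S)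
  occ≡entry i = trans (sym (occ-≡ lead~u i))
    (trans (cong (occ i ∘ leadingMonomial) (sym (indexTrees-components 0 ts ln (starts-positive ts))))
           (occ-leadingMonomial-indexTrees S i))
  counts≈exponents : TrailingEq 0 (allSpineCounts S) (exponents u)
  counts≈exponents = TrailingEq-sym (applyUpTo-TrailingEq _ _ _ occ≡entry (occ-beyond-weight u))

leadingMonomial-injective : ∀ F G → leadingMonomial (proj₁ F) ~ leadingMonomial (proj₁ G) → F ≡ G
leadingMonomial-injective F G F~G =
  Forest-≡ F G (trans (decode-leadingMonomial F _ F~G) (sym (decode-leadingMonomial G _ ~-refl)))

-- Spanning

record Spanned (p : Poly) : Set where
  constructor spannedBy
  field
    combination   : List (ℤ × Forest)
    ≈-combination : p ≈ lincomb combination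
open Spanned public

spanned-resp-≈ : ∀ {p q} → p ≈ q → Spanned q → Spanned p
spanned-resp-≈ p≈q (spannedBy cs q≈) = spannedBy cs λ m → trans (p≈q m) (q≈ m)

spanned-[] : Spanned []
spanned-[] = spannedBy [] λ _ → refl

spanned-++ : ∀ {p q} → Spanned p → Spanned q → Spanned (p ++ q)
spanned-++ {p} {q} (spannedBy cs p≈) (spannedBy ds q≈) =
  spannedBy (cs ++ ds) λ m → trans (coeff-++ p q m) (trans (cong₂ _+ℤ_ (p≈ m) (q≈ m)) (sym (coeff-lincomb-++ cs ds m)))

scaleCoeffs : ℤ → List (ℤ × Forest) → List (ℤ × Forest)
scaleCoeffs c = map (λ (d , F) → (c *ℤ d , F))

coeff-lincomb-scaleCoeffs : ∀ c cs m → coeff (lincomb (scaleCoeffs c cs)) m ≡ c *ℤ coeff (lincomb cs) m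
coeff-lincomb-scaleCoeffs c []             m = sym (ℤₚ.*-zeroʳ c)
coeff-lincomb-scaleCoeffs c ((d , F) ∷ cs) m = begin
  coeff (lincomb ((c *ℤ d , F) ∷ scaleCoeffs c cs)) m              ≡⟨ coeff-lincomb-∷ (c *ℤ d) F (scaleCoeffs c cs) m ⟩
  c *ℤ d *ℤ coeff (forestPoly F) m +ℤ coeff (lincomb (scaleCoeffs c cs)) m
    ≡⟨ cong₂ _+ℤ_ (ℤₚ.*-assoc c d _) (coeff-lincomb-scaleCoeffs c cs m) ⟩
  c *ℤ (d *ℤ coeff (forestPoly F) m) +ℤ c *ℤ coeff (lincomb cs) m ≡⟨ ℤₚ.*-distribˡ-+ c _ _ ⟨
  c *ℤ (d *ℤ coeff (forestPoly F) m +ℤ coeff (lincomb cs) m)      ≡⟨ cong (c *ℤ_) (coeff-lincomb-∷ d F cs m) ⟨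
  c *ℤ coeff (lincomb ((d , F) ∷ cs)) m                            ∎
  where open ≡-Reasoning

spanned-scale : ∀ c {p} → Spanned p → Spanned (scale c p)
spanned-scale c {p} (spannedBy cs p≈) =
  spannedBy (scaleCoeffs c cs) λ m → trans (coeff-scale c p m) (trans (cong (c *ℤ_) (p≈ m)) (sym (coeff-lincomb-scaleCoeffs c cs m)))

spanned-forestPoly : ∀ F → Spanned (forestPoly F)
spanned-forestPoly F =
  spannedBy [ (1ℤ , F) ] λ m → sym (trans (coeff-lincomb-∷ 1ℤ F [] m) (trans (ℤₚ.+-identityʳ _) (ℤₚ.*-identityˡ _)))

spanned-∷ : ∀ c {u p} → Spanned (monomial u) → Spanned p → Spanned ((c , u) ∷ p)
spanned-∷ c {u} u-spanned p-spanned = spanned-++ (spanned-resp-≈ term≈ (spanned-scale c u-spanned)) p-spanned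
  where
  term≈ : [ (c , u) ] ≈ scale c (monomial u)
  term≈ m with sameMono u m
  ... | true  = cong (_+ℤ 0ℤ) (sym (ℤₚ.*-identityʳ c))
  ... | false = refl

-- Induction on the weight: a monomial is 𝔓 of its decoding minus terms of smaller weight.
mutual
  monomial-spanned : ∀ n u → weight u < n → Spanned (monomial u)
  monomial-spanned (suc n) u (s≤s u≤n) =
    spanned-resp-≈ monomial≈ (spanned-++ (spanned-forestPoly F) (spanned-scale -1ℤ (lighter-spanned n rest rest<n)))
    where
    F = decode u
    lead = forestPoly-leading F
    rest = proj₁ lead
    monomial≈ : monomial u ≈ forestPoly F ++ scale -1ℤ rest
    monomial≈ m = trans (coeff-monomial-resp-~ m (~-sym (leadingMonomial-decode u))) (monomial≈leading-correction lead m)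
    rest<n : All (Below n) rest
    rest<n = All.map (λ t<F → ≤-trans (subst (_ <_) (sum-resp-~ (leadingMonomial-decode u)) t<F) u≤n) (proj₂ (proj₂ lead))

  lighter-spanned : ∀ n p → All (Below n) p → Spanned p
  lighter-spanned n []             []          = spanned-[]
  lighter-spanned n ((c , u) ∷ p) (u<n ∷ p<n) = spanned-∷ c (monomial-spanned n u u<n) (lighter-spanned n p p<n)

spanned : ∀ p → Spanned p
spanned []             = spanned-[]
spanned ((c , u) ∷ p) = spanned-∷ c (monomial-spanned (suc (weight u)) u ≤-refl) (spanned p)

-- Linear independence

max-by : ∀ {A : Set} (f : A → ℕ) x xs → Σ A λ y → Σ (List A) λ ys → x ∷ xs ↭ y ∷ ys × All (λ z → f z ≤ f y) ys
max-by f x []        = x , [] , ↭-refl , []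
max-by f x (x′ ∷ xs) with y , ys , x′∷xs↭ , ys≤y ← max-by f x′ xs | f x ≤? f y
... | yes x≤y = y , x ∷ ys , ↭-trans (prep x x′∷xs↭) (swap x y ↭-refl) , x≤y ∷ ys≤y
... | no  x≰y =
  x , x′ ∷ xs , ↭-refl , ↭ₚ.All-resp-↭ (↭-sym x′∷xs↭) (<⇒≤ y<x ∷ All.map (λ z≤y → ≤-trans z≤y (<⇒≤ y<x)) ys≤y)
  where y<x = ≰⇒> x≰y

Unique-resp-↭ : ∀ {A : Set} {xs ys : List A} → xs ↭ ys → Unique xs → Unique ys
Unique-resp-↭ {A} xs↭ys = PermutationSetoidₚ.Unique-resp-↭ (setoid A) (↭⇒↭ₛ xs↭ys)

forestWeight : Forest → ℕ
forestWeight F = weight (leadingMonomial (proj₁ F))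

coeff-lincomb-lighter : ∀ F cs → All (λ (_ , G) → G ≢ F) cs → All (λ (_ , G) → forestWeight G ≤ forestWeight F) cs →
                        coeff (lincomb cs) (leadingMonomial (proj₁ F)) ≡ 0ℤ
coeff-lincomb-lighter F []             []            []          = refl
coeff-lincomb-lighter F ((c , G) ∷ cs) (G≢F ∷ cs≢F) (G≤F ∷ cs≤F) = begin
  coeff (lincomb ((c , G) ∷ cs)) a                            ≡⟨ coeff-lincomb-∷ c G cs a ⟩
  c *ℤ coeff (forestPoly G) a +ℤ coeff (lincomb cs) a          ≡⟨ cong₂ (λ x y → c *ℤ x +ℤ y) coeff-G (coeff-lincomb-lighter F cs cs≢F cs≤F) ⟩
  c *ℤ 0ℤ +ℤ 0ℤ                                               ≡⟨ cong (_+ℤ 0ℤ) (ℤₚ.*-zeroʳ c) ⟩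
  0ℤ                                                          ∎
  where
  open ≡-Reasoning
  a = leadingMonomial (proj₁ F)
  coeff-G : coeff (forestPoly G) a ≡ 0ℤ
  coeff-G = trans (coeff-leading (forestPoly-leading G) a G≤F)
                  (coeff-monomial-≁ (λ G~F → G≢F (leadingMonomial-injective G F G~F)))

heaviest-coefficient-≡0 : ∀ c F cs → lincomb ((c , F) ∷ cs) ≈ 0P →
  All (λ (_ , G) → G ≢ F) cs → All (λ (_ , G) → forestWeight G ≤ forestWeight F) cs → c ≡ 0ℤ
heaviest-coefficient-≡0 c F cs combination≈0 cs≢F cs≤F = begin
  c                                                   ≡⟨ ℤₚ.+-identityʳ c ⟨
  c +ℤ 0ℤ                                             ≡⟨ cong₂ _+ℤ_ (ℤₚ.*-identityʳ c) (coeff-lincomb-lighter F cs cs≢F cs≤F) ⟨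
  c *ℤ 1ℤ +ℤ coeff (lincomb cs) a                      ≡⟨ cong (λ x → c *ℤ x +ℤ coeff (lincomb cs) a) coeff-F ⟨
  c *ℤ coeff (forestPoly F) a +ℤ coeff (lincomb cs) a  ≡⟨ coeff-lincomb-∷ c F cs a ⟨
  coeff (lincomb ((c , F) ∷ cs)) a                     ≡⟨ combination≈0 a ⟩
  0ℤ                                                  ∎
  where
  open ≡-Reasoning
  a = leadingMonomial (proj₁ F)
  coeff-F : coeff (forestPoly F) a ≡ 1ℤ
  coeff-F = trans (coeff-leading (forestPoly-leading F) a ≤-refl) (coeff-monomial-~ {a} ~-refl)

independent : ∀ n cs → length cs ≤ n → Unique (map proj₂ cs) → lincomb cs ≈ 0P → All (λ (c , _) → c ≡ 0ℤ) cs
independent n       []       _             _   _             = []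
independent (suc n) (e ∷ es) (s≤s |es|≤n) es! combination≈0
  with (c , F) , cs , e∷es↭ , cs≤F ← max-by (forestWeight ∘ proj₂) e es =
  ↭ₚ.All-resp-↭ (↭-sym e∷es↭) (c≡0 ∷ independent n cs |cs|≤n cs! cs-combination≈0)
  where
  |cs|≤n : length cs ≤ n
  |cs|≤n = subst (_≤ n) (suc-injective (↭ₚ.↭-length e∷es↭)) |es|≤n
  F∷cs! : Unique (F ∷ map proj₂ cs)
  F∷cs! = Unique-resp-↭ (↭ₚ.map⁺ proj₂ e∷es↭) es!
  cs! : Unique (map proj₂ cs)
  cs! = Uniqueₚ.drop⁺ 1 F∷cs!
  cs≢F : All (λ (_ , G) → G ≢ F) cs
  cs≢F with F∉cs ∷ _ ← F∷cs! = Allₚ.map⁻ (All.map (λ F≢G → F≢G ∘ sym) F∉cs)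
  permuted≈0 : lincomb ((c , F) ∷ cs) ≈ 0P
  permuted≈0 m = trans (sym (coeff-lincomb-↭ e∷es↭ m)) (combination≈0 m)
  c≡0 : c ≡ 0ℤ
  c≡0 = heaviest-coefficient-≡0 c F cs permuted≈0 cs≢F cs≤F
  cs-combination≈0 : lincomb cs ≈ 0P
  cs-combination≈0 m = begin
    coeff (lincomb cs) m                                   ≡⟨ ℤₚ.+-identityˡ _ ⟨
    0ℤ *ℤ coeff (forestPoly F) m +ℤ coeff (lincomb cs) m   ≡⟨ cong (λ x → x *ℤ coeff (forestPoly F) m +ℤ coeff (lincomb cs) m) c≡0 ⟨
    c *ℤ coeff (forestPoly F) m +ℤ coeff (lincomb cs) m    ≡⟨ coeff-lincomb-∷ c F cs m ⟨
    coeff (lincomb ((c , F) ∷ cs)) m                       ≡⟨ permuted≈0 m ⟩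
    0ℤ                                                     ∎
    where open ≡-Reasoning

theorem3p11 : IsBasisOfForestPolys
theorem3p11 =
  (λ p → combination (spanned p) , ≈-combination (spanned p)) ,
  (λ cs cs! combination≈0 → independent (length cs) cs ≤-refl cs! combination≈0)
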